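{- For every connected irregular graph $G$, $\Omega(G)=\mathrm{Var}(G)/S(G)<\tfrac12$, i.e. $\mathrm{Var}(G)<S(G)/2$. Moreover, for every $\varepsilon>0$ there exists $n_0$ such that for every $n\ge n_0$ there is an $n$-vertex connected irregular graph $G_n$ with $\left|\frac{\mathrm{Var}(G_n)}{S(G_n)}-\frac12\right|<\varepsilon$; for example, $G_n$ can be taken to be the star $K_{1,n-1}$ or the wheel $W_n$.
   Context: A graph is irregular if it has at least two distinct vertex degrees. For a graph with $n$ vertices, $m$ edges and degrees $d_1,\dots,d_n$: $S(G)=\sum_i|d_i-\frac{2m}{n}|$, $\mathrm{Var}(G)=\frac1n\sum_i(d_i-\frac{2m}{n})^2$. The wheel $W_n$ is the $n$-vertex graph obtained from a cycle on $n-1$ vertices by adding one vertex adjacent to all cycle vertices. -}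

module Defs where

open import Data.Bool using (Bool; true; false; _∧_; _∨_; not; if_then_else_)
open import Data.Bool.Properties using (∨-comm)
open import Data.Nat as ℕ using (ℕ; zero; suc; _≡ᵇ_; _<ᵇ_; _∸_)
open import Data.Fin using (Fin; toℕ)
open import Data.List using (List; map; allFin; foldr)
open import Data.Integer using (+_)
open import Data.Rational using (ℚ; 0ℚ; _/_; _+_; _*_; _-_; ∣_∣; _÷_; ≢-nonZero)
open import Data.Rational.Properties using (_≟_)
open import Data.Product using (Σ; ∃; _×_; _,_)
open import Relation.Binary.PropositionalEquality using (_≡_; _≢_; refl)
open import Relation.Nullary using (yes; no; ¬_)

record Graph (n : ℕ) : Set where
  field
    adj    : Fin n → Fin n → Bool
    sym    : ∀ i j → adj i j ≡ adj j i
    irrefl : ∀ i → adj i i ≡ false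
open Graph public

sumℕ : ∀ {n} → (Fin n → ℕ) → ℕ
sumℕ {n} f = foldr ℕ._+_ 0 (map f (allFin n))

sumℚ : ∀ {n} → (Fin n → ℚ) → ℚ
sumℚ {n} f = foldr _+_ 0ℚ (map f (allFin n))

b2n : Bool → ℕ
b2n true  = 1
b2n false = 0

degree : ∀ {n} → Graph n → Fin n → ℕ
degree G i = sumℕ (λ j → b2n (adj G i j))

edges : ∀ {n} → Graph n → ℕ
edges G = sumℕ (λ i → sumℕ (λ j → b2n ((toℕ i <ᵇ toℕ j) ∧ adj G i j)))

data Walk {n} (G : Graph n) : Fin n → Fin n → Set where
  here : ∀ {i} → Walk G i i
  step : ∀ {i j k} → adj G i j ≡ true → Walk G j k → Walk G i k

Connected : ∀ {n} → Graph n → Set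
Connected G = ∀ i j → Walk G i j

Irregular : ∀ {n} → Graph n → Set
Irregular G = Σ _ λ i → Σ _ λ j → degree G i ≢ degree G j

ℕtoℚ : ℕ → ℚ
ℕtoℚ k = + k / 1

-- 1/n as a rational (only used for n ≥ 1; the n = 0 value is irrelevant)
inv : ℕ → ℚ
inv zero    = 0ℚ
inv (suc k) = + 1 / suc k

avgDeg : ∀ {n} → Graph n → ℚ
avgDeg {n} G = ℕtoℚ (2 ℕ.* edges G) * inv n

S : ∀ {n} → Graph n → ℚ
S G = sumℚ (λ i → ∣ ℕtoℚ (degree G i) - avgDeg G ∣)

Var : ∀ {n} → Graph n → ℚ
Var {n} G = inv n * sumℚ (λ i → (ℕtoℚ (degree G i) - avgDeg G) * (ℕtoℚ (degree G i) - avgDeg G))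

-- Ω(G) = Var(G)/S(G)   (S(G) ≠ 0 for irregular graphs; value 0 when S(G) = 0)
divQ : ℚ → ℚ → ℚ
divQ p q with q ≟ 0ℚ
... | yes _ = 0ℚ
... | no q≢0 = _÷_ p q {{≢-nonZero q≢0}}

Ω : ∀ {n} → Graph n → ℚ
Ω G = divQ (Var G) (S G)

≡ᵇ-sym : ∀ a b → (a ≡ᵇ b) ≡ (b ≡ᵇ a)
≡ᵇ-sym zero zero = refl
≡ᵇ-sym zero (suc b) = refl
≡ᵇ-sym (suc a) zero = refl
≡ᵇ-sym (suc a) (suc b) = ≡ᵇ-sym a b

≡ᵇ-refl : ∀ a → (a ≡ᵇ a) ≡ true
≡ᵇ-refl zero = refl
≡ᵇ-refl (suc a) = ≡ᵇ-refl a

mkGraph : ∀ {n} → (Fin n → Fin n → Bool) → Graph n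
mkGraph f = record
  { adj    = λ i j → not (toℕ i ≡ᵇ toℕ j) ∧ (f i j ∨ f j i)
  ; sym    = λ i j → symm i j
  ; irrefl = λ i → irr i }
  where
  symm : ∀ i j → (not (toℕ i ≡ᵇ toℕ j) ∧ (f i j ∨ f j i)) ≡ (not (toℕ j ≡ᵇ toℕ i) ∧ (f j i ∨ f i j))
  symm i j rewrite ≡ᵇ-sym (toℕ i) (toℕ j) | ∨-comm (f i j) (f j i) = refl
  irr : ∀ i → (not (toℕ i ≡ᵇ toℕ i) ∧ (f i i ∨ f i i)) ≡ false
  irr i rewrite ≡ᵇ-refl (toℕ i) = refl

star : (n : ℕ) → Graph n
star n = mkGraph (λ i j → toℕ i ≡ᵇ 0)

-- the wheel W_n: vertex 0 is the hub; vertices 1,…,n-1 form the cycle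
-- 1 - 2 - … - (n-1) - 1, and the hub is adjacent to every cycle vertex
wheel : (n : ℕ) → Graph n
wheel n = mkGraph (λ i j → (toℕ i ≡ᵇ 0) ∨ (suc (toℕ i) ≡ᵇ toℕ j) ∨ ((toℕ i ≡ᵇ 1) ∧ (toℕ j ≡ᵇ (n ∸ 1))))

-- Let dᵢ = degᵢ − 2m/n be the degree deviations; they sum to 0 by the handshake lemma.
-- Since 0 ≤ degᵢ ≤ n − 1, each satisfies 2dᵢ² ≤ (n − 1)|dᵢ| + (n − 1 − 4m/n)dᵢ, and summing
-- gives n·Var = ∑ dᵢ² ≤ (n − 1)S/2 < n·S/2 as soon as S > 0, i.e. as soon as G is irregular.
-- If one vertex has degree n − 1 and all others degree C < n − 1 (the star with C = 1, the
-- wheel with C = 3), the deviations are (n − 1)w and −w with w = (n − 1 − C)/n, so Ω = w/2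
-- and |Ω − ½| = (1 + C)/(2n), which tends to 0.

module Submission where

module Irregularity where

  open import Defs renaming (sym to adj-sym)
  open import Data.Bool using (Bool; true; false; _∧_; _∨_; not; if_then_else_)
  open import Data.Bool.Properties using (∨-zeroʳ; ∨-identityʳ; ∧-zeroʳ; ∧-identityʳ; ∨-commutativeMonoid)
  open import Algebra.Solver.CommutativeMonoid ∨-commutativeMonoid using (_⊕_; _⊜_) renaming (solve to ∨-solve)
  open import Data.Nat as ℕ using (ℕ; zero; suc; _≡ᵇ_; _<ᵇ_; z≤n; s≤s)
  import Data.Nat.Properties as ℕₚ
  import Data.Nat.Coprimality as Coprimality
  open import Data.Fin using (Fin; toℕ; fromℕ<) renaming (zero to fzero; suc to fsuc)
  import Data.Fin.Properties as Finₚ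
  open import Data.Vec.Functional as Vector using (Vector; removeAt)
  open import Data.List using (map; tabulate; foldr)
  import Data.Integer as ℤ
  import Data.Integer.Properties as ℤₚ
  open import Data.Integer.Tactic.RingSolver using () renaming (solve-∀ to ℤ-solve-∀)
  open import Data.Rational
  open import Data.Rational.Properties
  open import Data.Rational.Solver using (module +-*-Solver)
  open +-*-Solver using (solve; _:=_; _:+_; _:*_; _:-_; :-_; con)
  import Data.Rational.Unnormalised as ℚᵘ
  import Data.Rational.Unnormalised.Properties as ℚᵘₚ
  open import Data.Product using (_×_; _,_)
  open import Data.Sum using (inj₁; inj₂)
  open import Data.Empty using (⊥-elim)
  open import Relation.Nullary.Decidable using (dec-true; dec-false)
  open import Function using (_∘_; id)
  open import Relation.Binary.PropositionalEquality
  open import Relation.Binary using (tri<; tri≈; tri>)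
  open import Relation.Nullary using (yes; no)
  open import Algebra.Bundles using (CommutativeRing)
  open import Algebra.Properties.Group +-0-group using () renaming (x∙y⁻¹≈ε⇒x≈y to x-y≡0⇒x≡y)
  import Algebra.Properties.Semiring.Sum as SemiringSum

  p≤p+q : ∀ p {q} → 0ℚ ≤ q → p ≤ p + q
  p≤p+q p {q} 0≤q = ≤-trans (≤-reflexive (sym (+-identityʳ p))) (+-monoʳ-≤ p 0≤q)

  p<p+q : ∀ p {q} → 0ℚ < q → p < p + q
  p<p+q p {q} 0<q = ≤-<-trans (≤-reflexive (sym (+-identityʳ p))) (+-monoʳ-< p 0<q)

  0≤p*q : ∀ {p q} → 0ℚ ≤ p → 0ℚ ≤ q → 0ℚ ≤ p * q
  0≤p*q {p} {q} 0≤p 0≤q = nonNegative⁻¹ _ {{nonNeg*nonNeg⇒nonNeg p {{nonNegative 0≤p}} q {{nonNegative 0≤q}}}}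

  p≤q⇒0≤q-p : ∀ {p q} → p ≤ q → 0ℚ ≤ q - p
  p≤q⇒0≤q-p {p} p≤q = ≤-trans (≤-reflexive (sym (+-inverseʳ p))) (+-monoˡ-≤ (- p) p≤q)

  0<∣p∣ : ∀ {p} → p ≢ 0ℚ → 0ℚ < ∣ p ∣
  0<∣p∣ {p} p≢0 with <-cmp 0ℚ ∣ p ∣
  ... | tri< 0<∣p∣ _ _ = 0<∣p∣
  ... | tri≈ _ 0≡∣p∣ _ = ⊥-elim (p≢0 (∣p∣≡0⇒p≡0 p (sym 0≡∣p∣)))
  ... | tri> _ _ ∣p∣<0 = ⊥-elim (<-irrefl refl (<-≤-trans ∣p∣<0 (0≤∣p∣ p)))

  ℕtoℚ≡mkℚ : ∀ k → ℕtoℚ k ≡ mkℚ (ℤ.+ k) 0 (Coprimality.sym (Coprimality.1-coprimeTo k))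
  ℕtoℚ≡mkℚ k = normalize-coprime _

  ℕtoℚ-suc : ∀ k → ℕtoℚ (suc k) ≡ 1ℚ + ℕtoℚ k
  ℕtoℚ-suc k = toℚᵘ-injective (ℚᵘₚ.≃-trans homo (ℚᵘₚ.≃-sym (toℚᵘ-homo-+ 1ℚ (ℕtoℚ k))))
    where
    homo : toℚᵘ (ℕtoℚ (suc k)) ℚᵘ.≃ toℚᵘ 1ℚ ℚᵘ.+ toℚᵘ (ℕtoℚ k)
    homo rewrite ℕtoℚ≡mkℚ (suc k) | ℕtoℚ≡mkℚ k = ℚᵘ.*≡* (cross-multiplied (ℤ.+ k))
      where
      cross-multiplied : ∀ i → (ℤ.1ℤ ℤ.+ i) ℤ.* (ℤ.1ℤ ℤ.* ℤ.1ℤ)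
                               ≡ (ℤ.1ℤ ℤ.* ℤ.1ℤ ℤ.+ i ℤ.* ℤ.1ℤ) ℤ.* ℤ.1ℤ
      cross-multiplied = ℤ-solve-∀

  ℕtoℚ-homo-+ : ∀ a b → ℕtoℚ (a ℕ.+ b) ≡ ℕtoℚ a + ℕtoℚ b
  ℕtoℚ-homo-+ zero    b = sym (+-identityˡ (ℕtoℚ b))
  ℕtoℚ-homo-+ (suc a) b = begin
    ℕtoℚ (suc (a ℕ.+ b))          ≡⟨ ℕtoℚ-suc (a ℕ.+ b) ⟩
    1ℚ + ℕtoℚ (a ℕ.+ b)           ≡⟨ cong (1ℚ +_) (ℕtoℚ-homo-+ a b) ⟩
    1ℚ + (ℕtoℚ a + ℕtoℚ b)        ≡⟨ +-assoc 1ℚ (ℕtoℚ a) (ℕtoℚ b) ⟨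
    (1ℚ + ℕtoℚ a) + ℕtoℚ b        ≡⟨ cong (_+ ℕtoℚ b) (ℕtoℚ-suc a) ⟨
    ℕtoℚ (suc a) + ℕtoℚ b         ∎
    where open ≡-Reasoning

  0≤ℕtoℚ : ∀ k → 0ℚ ≤ ℕtoℚ k
  0≤ℕtoℚ k rewrite ℕtoℚ≡mkℚ k = nonNegative⁻¹ _

  ℕtoℚ-mono-≤ : ∀ {a b} → a ℕ.≤ b → ℕtoℚ a ≤ ℕtoℚ b
  ℕtoℚ-mono-≤ {a} {b} a≤b = begin
    ℕtoℚ a                        ≤⟨ p≤p+q (ℕtoℚ a) (0≤ℕtoℚ (b ℕ.∸ a)) ⟩
    ℕtoℚ a + ℕtoℚ (b ℕ.∸ a)       ≡⟨ ℕtoℚ-homo-+ a (b ℕ.∸ a) ⟨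
    ℕtoℚ (a ℕ.+ (b ℕ.∸ a))        ≡⟨ cong ℕtoℚ (ℕₚ.m+[n∸m]≡n a≤b) ⟩
    ℕtoℚ b                        ∎
    where open ≤-Reasoning

  ℕtoℚ-injective : ∀ {a b} → ℕtoℚ a ≡ ℕtoℚ b → a ≡ b
  ℕtoℚ-injective {a} {b} eq rewrite ℕtoℚ≡mkℚ a | ℕtoℚ≡mkℚ b with eq
  ... | refl = refl

  0≤inv : ∀ n → 0ℚ ≤ inv n
  0≤inv zero    = ≤-refl
  0≤inv (suc n) rewrite normalize-coprime {1} {n} (Coprimality.1-coprimeTo (suc n)) = nonNegative⁻¹ _

  ℕtoℚ*inv≡1 : ∀ n .{{_ : ℕ.NonZero n}} → ℕtoℚ n * inv n ≡ 1ℚ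
  ℕtoℚ*inv≡1 (suc n) = trans (cong (ℕtoℚ (suc n) *_) inv≡1/) (*-inverseʳ (ℕtoℚ (suc n)) {{n≢0}})
    where
    n≢0 : NonZero (ℕtoℚ (suc n))
    n≢0 rewrite ℕtoℚ≡mkℚ (suc n) = _
    inv≡1/ : inv (suc n) ≡ (1/ ℕtoℚ (suc n)) {{n≢0}}
    inv≡1/ rewrite ℕtoℚ≡mkℚ (suc n) = normalize-coprime (Coprimality.1-coprimeTo (suc n))

  module ∑ℚ = SemiringSum (CommutativeRing.semiring +-*-commutativeRing)
  module ∑ℕ = SemiringSum ℕₚ.+-*-semiring
  open ∑ℚ using (sum)

  foldr-map-tabulate : ∀ {A B : Set} (_∙_ : A → B → B) (e : B) {m n} (f : Fin m → A) (g : Fin n → Fin m) →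
                       foldr _∙_ e (map f (tabulate g)) ≡ Vector.foldr _∙_ e (f ∘ g)
  foldr-map-tabulate _∙_ e {n = zero}  f g = refl
  foldr-map-tabulate _∙_ e {n = suc n} f g = cong (f (g fzero) ∙_) (foldr-map-tabulate _∙_ e f (g ∘ fsuc))

  sumℚ≡sum : ∀ {n} (f : Fin n → ℚ) → sumℚ f ≡ sum f
  sumℚ≡sum f = foldr-map-tabulate _+_ 0ℚ f id

  sumℕ≡sum : ∀ {n} (f : Fin n → ℕ) → sumℕ f ≡ ∑ℕ.sum f
  sumℕ≡sum f = foldr-map-tabulate ℕ._+_ 0 f id

  sum-mono-≤ : ∀ {n} {f g : Vector ℚ n} → (∀ i → f i ≤ g i) → sum f ≤ sum g
  sum-mono-≤ {zero}  f≤g = ≤-refl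
  sum-mono-≤ {suc n} f≤g = +-mono-≤ (f≤g fzero) (sum-mono-≤ (f≤g ∘ fsuc))

  0≤sum : ∀ {n} {f : Vector ℚ n} → (∀ i → 0ℚ ≤ f i) → 0ℚ ≤ sum f
  0≤sum {zero}  0≤f = ≤-refl
  0≤sum {suc n} 0≤f = +-mono-≤ (0≤f fzero) (0≤sum (0≤f ∘ fsuc))

  ≤sum : ∀ {n} {f : Vector ℚ n} → (∀ i → 0ℚ ≤ f i) → ∀ i → f i ≤ sum f
  ≤sum {suc n} {f} 0≤f fzero    = p≤p+q (f fzero) (0≤sum (0≤f ∘ fsuc))
  ≤sum {suc n} {f} 0≤f (fsuc i) = begin
    f (fsuc i)                 ≤⟨ ≤sum (0≤f ∘ fsuc) i ⟩
    sum (f ∘ fsuc)             ≤⟨ p≤p+q _ (0≤f fzero) ⟩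
    sum (f ∘ fsuc) + f fzero   ≡⟨ +-comm _ (f fzero) ⟩
    sum f                      ∎
    where open ≤-Reasoning

  sum-ℕtoℚ : ∀ {n} (f : Vector ℕ n) → sum (ℕtoℚ ∘ f) ≡ ℕtoℚ (∑ℕ.sum f)
  sum-ℕtoℚ {zero}  f = refl
  sum-ℕtoℚ {suc n} f = trans (cong (ℕtoℚ (f fzero) +_) (sum-ℕtoℚ (f ∘ fsuc)))
                             (sym (ℕtoℚ-homo-+ (f fzero) (∑ℕ.sum (f ∘ fsuc))))

  sum-const : ∀ n (c : ℚ) → sum {n} (λ _ → c) ≡ ℕtoℚ n * c
  sum-const zero    c = sym (*-zeroˡ c)
  sum-const (suc n) c = begin
    c + sum {n} (λ _ → c)      ≡⟨ cong (c +_) (sum-const n c) ⟩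
    c + ℕtoℚ n * c             ≡⟨ distrib (ℕtoℚ n) c ⟩
    (1ℚ + ℕtoℚ n) * c          ≡⟨ cong (_* c) (ℕtoℚ-suc n) ⟨
    ℕtoℚ (suc n) * c           ∎
    where
    open ≡-Reasoning
    distrib : ∀ x y → y + x * y ≡ (1ℚ + x) * y
    distrib = solve 2 (λ x y → y :+ x :* y := (con 1ℚ :+ x) :* y) refl

  sum-sub-const : ∀ {n} (f : Vector ℚ n) c → sum (λ i → f i - c) ≡ sum f - ℕtoℚ n * c
  sum-sub-const {n} f c = begin
    sum (λ i → f i - c)          ≡⟨ ∑ℚ.∑-distrib-+ f (λ _ → - c) ⟩
    sum f + sum {n} (λ _ → - c)  ≡⟨ cong (sum f +_) (sum-const n (- c)) ⟩
    sum f + ℕtoℚ n * - c         ≡⟨ cong (sum f +_) (neg-distribʳ-* (ℕtoℚ n) c) ⟨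
    sum f - ℕtoℚ n * c           ∎
    where open ≡-Reasoning

  ∑ℕ-const : ∀ n k → ∑ℕ.sum {n} (λ _ → k) ≡ n ℕ.* k
  ∑ℕ-const zero    k = refl
  ∑ℕ-const (suc n) k = cong (k ℕ.+_) (∑ℕ-const n k)

  ∑ℕ-≤-card : ∀ {n} {f : Vector ℕ n} → (∀ i → f i ℕ.≤ 1) → ∑ℕ.sum f ℕ.≤ n
  ∑ℕ-≤-card {zero}  f≤1 = z≤n
  ∑ℕ-≤-card {suc n} f≤1 = ℕₚ.+-mono-≤ (f≤1 fzero) (∑ℕ-≤-card (f≤1 ∘ fsuc))

  ∑ℕ[j≡v]≡1 : ∀ {n v} → v ℕ.< n → ∑ℕ.sum {n} (λ j → b2n (toℕ j ≡ᵇ v)) ≡ 1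
  ∑ℕ[j≡v]≡1 {suc n} {zero}  _         = cong suc (∑ℕ.sum-replicate-zero n)
  ∑ℕ[j≡v]≡1 {suc n} {suc v} (s≤s v<n) = ∑ℕ[j≡v]≡1 v<n

  -- Degrees and the handshake lemma

  degree≡∑ : ∀ {n} (G : Graph n) i → degree G i ≡ ∑ℕ.sum (b2n ∘ adj G i)
  degree≡∑ G i = sumℕ≡sum (b2n ∘ adj G i)

  counted : ∀ {n} → Graph n → Fin n → Fin n → ℕ
  counted G i j = b2n ((toℕ i <ᵇ toℕ j) ∧ adj G i j)

  b2n-adj≡counted+counted : ∀ {n} (G : Graph n) i j → b2n (adj G i j) ≡ counted G i j ℕ.+ counted G j i
  b2n-adj≡counted+counted G i j with ℕₚ.<-cmp (toℕ i) (toℕ j)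
  ... | tri< i<j _ j≮i
    rewrite dec-true (toℕ i ℕₚ.<? toℕ j) i<j | dec-false (toℕ j ℕₚ.<? toℕ i) j≮i
    = sym (ℕₚ.+-identityʳ _)
  ... | tri> i≮j _ j<i
    rewrite dec-false (toℕ i ℕₚ.<? toℕ j) i≮j | dec-true (toℕ j ℕₚ.<? toℕ i) j<i
    = cong b2n (adj-sym G i j)
  ... | tri≈ _ i≡j _ rewrite Finₚ.toℕ-injective i≡j | irrefl G j | ∧-zeroʳ (toℕ j <ᵇ toℕ j) = refl

  handshake : ∀ {n} (G : Graph n) → ∑ℕ.sum (degree G) ≡ 2 ℕ.* edges G
  handshake G = begin
    ∑ℕ.sum (degree G)
      ≡⟨ ∑ℕ.sum-cong-≗ (degree≡∑ G) ⟩
    ∑ℕ.sum (λ i → ∑ℕ.sum (λ j → b2n (adj G i j)))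
      ≡⟨ ∑ℕ.sum-cong-≗ (λ i → ∑ℕ.sum-cong-≗ (b2n-adj≡counted+counted G i)) ⟩
    ∑ℕ.sum (λ i → ∑ℕ.sum (λ j → counted G i j ℕ.+ counted G j i))
      ≡⟨ ∑ℕ.sum-cong-≗ (λ i → ∑ℕ.∑-distrib-+ (counted G i) (λ j → counted G j i)) ⟩
    ∑ℕ.sum (λ i → ∑ℕ.sum (counted G i) ℕ.+ ∑ℕ.sum (λ j → counted G j i))
      ≡⟨ ∑ℕ.∑-distrib-+ (∑ℕ.sum ∘ counted G) (λ i → ∑ℕ.sum (λ j → counted G j i)) ⟩
    ∑ℕ.sum (∑ℕ.sum ∘ counted G) ℕ.+ ∑ℕ.sum (λ i → ∑ℕ.sum (λ j → counted G j i))
      ≡⟨ cong (∑ℕ.sum (∑ℕ.sum ∘ counted G) ℕ.+_) (∑ℕ.∑-comm (counted G)) ⟨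
    ∑ℕ.sum (∑ℕ.sum ∘ counted G) ℕ.+ ∑ℕ.sum (∑ℕ.sum ∘ counted G)
      ≡⟨ cong (λ m → m ℕ.+ m) edges≡∑∑counted ⟨
    edges G ℕ.+ edges G
      ≡⟨ cong (edges G ℕ.+_) (ℕₚ.+-identityʳ (edges G)) ⟨
    2 ℕ.* edges G
      ∎
    where
    open ≡-Reasoning
    edges≡∑∑counted : edges G ≡ ∑ℕ.sum (∑ℕ.sum ∘ counted G)
    edges≡∑∑counted = trans (sumℕ≡sum (sumℕ ∘ counted G)) (∑ℕ.sum-cong-≗ (sumℕ≡sum ∘ counted G))

  degree≤n-1 : ∀ {n} (G : Graph (suc n)) i → degree G i ℕ.≤ n
  degree≤n-1 {n} G i = begin
    degree G i                                   ≡⟨ degree≡∑ G i ⟩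
    ∑ℕ.sum (b2n ∘ adj G i)                       ≡⟨ ∑ℕ.sum-remove {i = i} (b2n ∘ adj G i) ⟩
    b2n (adj G i i) ℕ.+ ∑ℕ.sum others            ≡⟨ cong (λ b → b2n b ℕ.+ ∑ℕ.sum others) (irrefl G i) ⟩
    ∑ℕ.sum others                                ≤⟨ ∑ℕ-≤-card (λ j → b2n≤1 (adj G i _)) ⟩
    n                                            ∎
    where
    open ℕₚ.≤-Reasoning
    others : Vector ℕ n
    others = removeAt (b2n ∘ adj G i) i
    b2n≤1 : ∀ b → b2n b ℕ.≤ 1
    b2n≤1 true  = s≤s z≤n
    b2n≤1 false = z≤n

  deviation : ∀ {n} → Graph n → Fin n → ℚ
  deviation G i = ℕtoℚ (degree G i) - avgDeg G

  S≡∑∣deviation∣ : ∀ {n} (G : Graph n) → S G ≡ sum (∣_∣ ∘ deviation G)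
  S≡∑∣deviation∣ G = sumℚ≡sum (∣_∣ ∘ deviation G)

  Var≡inv*∑deviation² : ∀ {n} (G : Graph n) → Var G ≡ inv n * sum (λ i → deviation G i * deviation G i)
  Var≡inv*∑deviation² {n} G = cong (inv n *_) (sumℚ≡sum (λ i → deviation G i * deviation G i))

  ∑degree≡2m : ∀ {n} (G : Graph n) → sum (ℕtoℚ ∘ degree G) ≡ ℕtoℚ (2 ℕ.* edges G)
  ∑degree≡2m G = trans (sum-ℕtoℚ (degree G)) (cong ℕtoℚ (handshake G))

  ∑deviation≡0 : ∀ {n} (G : Graph (suc n)) → sum (deviation G) ≡ 0ℚ
  ∑deviation≡0 {n} G = begin
    sum (deviation G)                     ≡⟨ sum-sub-const (ℕtoℚ ∘ degree G) (avgDeg G) ⟩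
    sum (ℕtoℚ ∘ degree G) - N * (D * t)   ≡⟨ cong (_- N * (D * t)) (∑degree≡2m G) ⟩
    D - N * (D * t)                       ≡⟨ rearrange D N t ⟩
    D - D * (N * t)                       ≡⟨ cong (λ u → D - D * u) (ℕtoℚ*inv≡1 (suc n)) ⟩
    D - D * 1ℚ                            ≡⟨ cancel D ⟩
    0ℚ                                    ∎
    where
    open ≡-Reasoning
    N D t : ℚ
    N = ℕtoℚ (suc n)
    D = ℕtoℚ (2 ℕ.* edges G)
    t = inv (suc n)
    rearrange : ∀ D N t → D - N * (D * t) ≡ D - D * (N * t)
    rearrange = solve 3 (λ D N t → D :- N :* (D :* t) := D :- D :* (N :* t)) refl
    cancel : ∀ D → D - D * 1ℚ ≡ 0ℚ
    cancel = solve 1 (λ D → D :- D :* con 1ℚ := con 0ℚ) refl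

  -- The inequality Var(G) < S(G)/2

  -- For a = x - c the gap between the two sides is 2a(K - x) if a ≥ 0 and -2a·x if a ≤ 0.
  2[x-c]²≤K∣x-c∣+[K-2c][x-c] : ∀ {K c x} → 0ℚ ≤ x → x ≤ K →
    (x - c) * (x - c) + (x - c) * (x - c) ≤ K * ∣ x - c ∣ + (K - (c + c)) * (x - c)
  2[x-c]²≤K∣x-c∣+[K-2c][x-c] {K} {c} {x} 0≤x x≤K with ≤-total 0ℚ (x - c)
  ... | inj₁ 0≤x-c = begin
    (x - c) * (x - c) + (x - c) * (x - c)
      ≤⟨ p≤p+q _ (0≤p*q (+-mono-≤ 0≤x-c 0≤x-c) (p≤q⇒0≤q-p x≤K)) ⟩
    (x - c) * (x - c) + (x - c) * (x - c) + ((x - c) + (x - c)) * (K - x)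
      ≡⟨ gap K c x ⟩
    K * (x - c) + (K - (c + c)) * (x - c)
      ≡⟨ cong (λ a → K * a + (K - (c + c)) * (x - c)) (0≤p⇒∣p∣≡p 0≤x-c) ⟨
    K * ∣ x - c ∣ + (K - (c + c)) * (x - c)
      ∎
    where
    open ≤-Reasoning
    gap : ∀ K c x → (x - c) * (x - c) + (x - c) * (x - c) + ((x - c) + (x - c)) * (K - x)
                    ≡ K * (x - c) + (K - (c + c)) * (x - c)
    gap = solve 3 (λ K c x → (x :- c) :* (x :- c) :+ (x :- c) :* (x :- c) :+ ((x :- c) :+ (x :- c)) :* (K :- x)
                          := K :* (x :- c) :+ (K :- (c :+ c)) :* (x :- c)) refl
  ... | inj₂ x-c≤0 = begin
    (x - c) * (x - c) + (x - c) * (x - c)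
      ≤⟨ p≤p+q _ (0≤p*q (+-mono-≤ 0≤c-x 0≤c-x) 0≤x) ⟩
    (x - c) * (x - c) + (x - c) * (x - c) + (- (x - c) + - (x - c)) * x
      ≡⟨ gap K c x ⟩
    K * - (x - c) + (K - (c + c)) * (x - c)
      ≡⟨ cong (λ a → K * a + (K - (c + c)) * (x - c)) ∣x-c∣≡c-x ⟨
    K * ∣ x - c ∣ + (K - (c + c)) * (x - c)
      ∎
    where
    open ≤-Reasoning
    0≤c-x : 0ℚ ≤ - (x - c)
    0≤c-x = neg-antimono-≤ x-c≤0
    ∣x-c∣≡c-x : ∣ x - c ∣ ≡ - (x - c)
    ∣x-c∣≡c-x = trans (sym (∣-p∣≡∣p∣ (x - c))) (0≤p⇒∣p∣≡p 0≤c-x)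
    gap : ∀ K c x → (x - c) * (x - c) + (x - c) * (x - c) + (- (x - c) + - (x - c)) * x
                    ≡ K * - (x - c) + (K - (c + c)) * (x - c)
    gap = solve 3 (λ K c x → (x :- c) :* (x :- c) :+ (x :- c) :* (x :- c) :+ (:- (x :- c) :+ :- (x :- c)) :* x
                          := K :* :- (x :- c) :+ (K :- (c :+ c)) :* (x :- c)) refl

  2∑[x-c]²≤K∑∣x-c∣ : ∀ {n} (K c : ℚ) (x : Vector ℚ n) →
    (∀ i → 0ℚ ≤ x i) → (∀ i → x i ≤ K) → sum (λ i → x i - c) ≡ 0ℚ →
    sum (λ i → (x i - c) * (x i - c)) + sum (λ i → (x i - c) * (x i - c)) ≤ K * sum (λ i → ∣ x i - c ∣)
  2∑[x-c]²≤K∑∣x-c∣ K c x 0≤x x≤K ∑[x-c]≡0 = begin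
    sum sq + sum sq
      ≡⟨ ∑ℚ.∑-distrib-+ sq sq ⟨
    sum (λ i → sq i + sq i)
      ≤⟨ sum-mono-≤ (λ i → 2[x-c]²≤K∣x-c∣+[K-2c][x-c] (0≤x i) (x≤K i)) ⟩
    sum (λ i → K * ∣ a i ∣ + L * a i)
      ≡⟨ ∑ℚ.∑-distrib-+ (λ i → K * ∣ a i ∣) (λ i → L * a i) ⟩
    sum (λ i → K * ∣ a i ∣) + sum (λ i → L * a i)
      ≡⟨ cong₂ _+_ (∑ℚ.*-distribˡ-sum K (∣_∣ ∘ a)) (∑ℚ.*-distribˡ-sum L a) ⟨
    K * sum (∣_∣ ∘ a) + L * sum a
      ≡⟨ cong (λ s → K * sum (∣_∣ ∘ a) + L * s) ∑[x-c]≡0 ⟩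
    K * sum (∣_∣ ∘ a) + L * 0ℚ
      ≡⟨ cong (K * sum (∣_∣ ∘ a) +_) (*-zeroʳ L) ⟩
    K * sum (∣_∣ ∘ a) + 0ℚ
      ≡⟨ +-identityʳ _ ⟩
    K * sum (∣_∣ ∘ a)
      ∎
    where
    open ≤-Reasoning
    a : Vector ℚ _
    a i = x i - c
    sq : Vector ℚ _
    sq i = a i * a i
    L : ℚ
    L = K - (c + c)

  0<∑∣x-c∣ : ∀ {n} (x : Vector ℚ n) c {i j} → x i ≢ x j → 0ℚ < sum (λ k → ∣ x k - c ∣)
  0<∑∣x-c∣ x c {i} {j} xi≢xj with x i ≟ c | x j ≟ c
  ... | yes xi≡c | yes xj≡c = ⊥-elim (xi≢xj (trans xi≡c (sym xj≡c)))
  ... | no xi≢c  | _        = <-≤-trans (0<∣p∣ (xi≢c ∘ x-y≡0⇒x≡y (x i) c)) (≤sum 0≤∣x-c∣ i)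
    where
    0≤∣x-c∣ : ∀ k → 0ℚ ≤ ∣ x k - c ∣
    0≤∣x-c∣ k = 0≤∣p∣ (x k - c)
  ... | yes _    | no xj≢c  = <-≤-trans (0<∣p∣ (xj≢c ∘ x-y≡0⇒x≡y (x j) c)) (≤sum 0≤∣x-c∣ j)
    where
    0≤∣x-c∣ : ∀ k → 0ℚ ≤ ∣ x k - c ∣
    0≤∣x-c∣ k = 0≤∣p∣ (x k - c)

  0<S : ∀ {n} (G : Graph n) → Irregular G → 0ℚ < S G
  0<S G (i , j , di≢dj) = subst (0ℚ <_) (sym (S≡∑∣deviation∣ G))
    (0<∑∣x-c∣ (ℕtoℚ ∘ degree G) (avgDeg G) (di≢dj ∘ ℕtoℚ-injective))

  Var<½S : ∀ {n} (G : Graph (suc n)) → 0ℚ < S G → Var G < ½ * S G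
  Var<½S {n} G 0<SG = *-cancelʳ-<-nonNeg (N + N) {{nonNegative 0≤N+N}} (begin-strict
    Var G * (N + N)             ≡⟨ cong (_* (N + N)) (Var≡inv*∑deviation² G) ⟩
    t * Q * (N + N)             ≡⟨ rearrange t Q N ⟩
    (N * t) * (Q + Q)           ≡⟨ cong (_* (Q + Q)) (ℕtoℚ*inv≡1 (suc n)) ⟩
    1ℚ * (Q + Q)                ≡⟨ *-identityˡ (Q + Q) ⟩
    Q + Q                       ≤⟨ 2∑[x-c]²≤K∑∣x-c∣ K (avgDeg G) (ℕtoℚ ∘ degree G)
                                     (0≤ℕtoℚ ∘ degree G) (ℕtoℚ-mono-≤ ∘ degree≤n-1 G) (∑deviation≡0 G) ⟩
    K * A                       <⟨ p<p+q (K * A) 0<A ⟩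
    K * A + A                   ≡⟨ regroup K A ⟩
    ½ * A * ((1ℚ + K) + (1ℚ + K)) ≡⟨ cong (λ m → ½ * A * (m + m)) (ℕtoℚ-suc n) ⟨
    ½ * A * (N + N)             ≡⟨ cong (λ s → ½ * s * (N + N)) (S≡∑∣deviation∣ G) ⟨
    ½ * S G * (N + N)           ∎)
    where
    open ≤-Reasoning
    N K t Q A : ℚ
    N = ℕtoℚ (suc n)
    K = ℕtoℚ n
    t = inv (suc n)
    Q = sum (λ i → deviation G i * deviation G i)
    A = sum (∣_∣ ∘ deviation G)
    0<A : 0ℚ < A
    0<A = subst (0ℚ <_) (S≡∑∣deviation∣ G) 0<SG
    0≤N+N : 0ℚ ≤ N + N
    0≤N+N = +-mono-≤ (0≤ℕtoℚ (suc n)) (0≤ℕtoℚ (suc n))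
    rearrange : ∀ t Q N → t * Q * (N + N) ≡ (N * t) * (Q + Q)
    rearrange = solve 3 (λ t Q N → t :* Q :* (N :+ N) := (N :* t) :* (Q :+ Q)) refl
    regroup : ∀ K A → K * A + A ≡ ½ * A * ((1ℚ + K) + (1ℚ + K))
    regroup = solve 2 (λ K A → K :* A :+ A := con ½ :* A :* ((con 1ℚ :+ K) :+ (con 1ℚ :+ K))) refl

  divQ≡÷ : ∀ p q (q≢0 : q ≢ 0ℚ) → divQ p q ≡ (p ÷ q) {{≢-nonZero q≢0}}
  divQ≡÷ p q q≢0 with q ≟ 0ℚ
  ... | yes q≡0 = ⊥-elim (q≢0 q≡0)
  ... | no _    = refl

  divQ[r*q,q]≡r : ∀ r q → q ≢ 0ℚ → divQ (r * q) q ≡ r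
  divQ[r*q,q]≡r r q q≢0 = begin
    divQ (r * q) q     ≡⟨ divQ≡÷ (r * q) q q≢0 ⟩
    r * q * 1/ q       ≡⟨ *-assoc r q (1/ q) ⟩
    r * (q * 1/ q)     ≡⟨ cong (r *_) (*-inverseʳ q) ⟩
    r * 1ℚ             ≡⟨ *-identityʳ r ⟩
    r                  ∎
    where
    open ≡-Reasoning
    instance
      _ : NonZero q
      _ = ≢-nonZero q≢0

  divQ-< : ∀ {p q r} → 0ℚ < q → p < r * q → divQ p q < r
  divQ-< {p} {q} {r} 0<q p<rq = subst (_< r) (sym (divQ≡÷ p q q≢0))
    (*-cancelˡ-<-nonNeg q {{nonNegative (<⇒≤ 0<q)}} (begin-strict
      q * (p * 1/ q)   ≡⟨ *-comm q (p * 1/ q) ⟩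
      p * 1/ q * q     ≡⟨ *-assoc p (1/ q) q ⟩
      p * (1/ q * q)   ≡⟨ cong (p *_) (*-inverseˡ q) ⟩
      p * 1ℚ           ≡⟨ *-identityʳ p ⟩
      p                <⟨ p<rq ⟩
      r * q            ≡⟨ *-comm r q ⟩
      q * r            ∎))
    where
    open ≤-Reasoning
    q≢0 : q ≢ 0ℚ
    q≢0 q≡0 = <-irrefl (sym q≡0) 0<q
    instance
      _ : NonZero q
      _ = ≢-nonZero q≢0

  Ω<½∧Var<½S : ∀ {n} (G : Graph n) → Irregular G → (Ω G < ½) × (Var G < ½ * S G)
  Ω<½∧Var<½S {zero}  G (() , _)
  Ω<½∧Var<½S {suc n} G irregular = divQ-< (0<S G irregular) Var<½SG , Var<½SG
    where
    Var<½SG : Var G < ½ * S G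
    Var<½SG = Var<½S G (0<S G irregular)

  -- Graphs with a vertex of full degree and all other degrees equal

  module TwoDegrees {N C : ℕ} (G : Graph (suc N))
                    (hub : degree G fzero ≡ N) (rim : ∀ i → degree G (fsuc i) ≡ C) (C<N : C ℕ.< N) where

    K c t w : ℚ
    K = ℕtoℚ N
    c = ℕtoℚ C
    t = inv (suc N)
    w = t * (K - c)

    [1+K]*t≡1 : (1ℚ + K) * t ≡ 1ℚ
    [1+K]*t≡1 = trans (cong (_* t) (sym (ℕtoℚ-suc N))) (ℕtoℚ*inv≡1 (suc N))

    0≤w : 0ℚ ≤ w
    0≤w = 0≤p*q (0≤inv (suc N)) (p≤q⇒0≤q-p (ℕtoℚ-mono-≤ (ℕₚ.<⇒≤ C<N)))

    irregular : Irregular G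
    irregular = fzero , fsuc i , λ d₀≡dᵢ → ℕₚ.<-irrefl (trans (sym (rim i)) (trans (sym d₀≡dᵢ) hub)) C<N
      where
      i : Fin N
      i = fromℕ< (ℕₚ.≤-<-trans z≤n C<N)

    avgDeg≡ : avgDeg G ≡ (K + K * c) * t
    avgDeg≡ = cong (_* t) (begin
      ℕtoℚ (2 ℕ.* edges G)
        ≡⟨ ∑degree≡2m G ⟨
      ℕtoℚ (degree G fzero) + sum (ℕtoℚ ∘ degree G ∘ fsuc)
        ≡⟨ cong₂ _+_ (cong ℕtoℚ hub) (∑ℚ.sum-cong-≗ (cong ℕtoℚ ∘ rim)) ⟩
      K + sum {N} (λ _ → c)
        ≡⟨ cong (K +_) (sum-const N c) ⟩
      K + K * c
        ∎)
      where open ≡-Reasoning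

    deviation-hub : deviation G fzero ≡ K * w
    deviation-hub = begin
      ℕtoℚ (degree G fzero) - avgDeg G                ≡⟨ cong₂ _-_ (cong ℕtoℚ hub) avgDeg≡ ⟩
      K - (K + K * c) * t                             ≡⟨ cong (λ u → u - (K + K * c) * t) (*-identityʳ K) ⟨
      K * 1ℚ - (K + K * c) * t                        ≡⟨ cong (λ u → K * u - (K + K * c) * t) [1+K]*t≡1 ⟨
      K * ((1ℚ + K) * t) - (K + K * c) * t            ≡⟨ simplify K c t ⟩
      K * w                                           ∎
      where
      open ≡-Reasoning
      simplify : ∀ K c t → K * ((1ℚ + K) * t) - (K + K * c) * t ≡ K * (t * (K - c))
      simplify = solve 3 (λ K c t → K :* ((con 1ℚ :+ K) :* t) :- (K :+ K :* c) :* t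
                                 := K :* (t :* (K :- c))) refl

    deviation-rim : ∀ i → deviation G (fsuc i) ≡ - w
    deviation-rim i = begin
      ℕtoℚ (degree G (fsuc i)) - avgDeg G             ≡⟨ cong₂ _-_ (cong ℕtoℚ (rim i)) avgDeg≡ ⟩
      c - (K + K * c) * t                             ≡⟨ cong (λ u → u - (K + K * c) * t) (*-identityʳ c) ⟨
      c * 1ℚ - (K + K * c) * t                        ≡⟨ cong (λ u → c * u - (K + K * c) * t) [1+K]*t≡1 ⟨
      c * ((1ℚ + K) * t) - (K + K * c) * t            ≡⟨ simplify K c t ⟩
      - w                                             ∎
      where
      open ≡-Reasoning
      simplify : ∀ K c t → c * ((1ℚ + K) * t) - (K + K * c) * t ≡ - (t * (K - c))
      simplify = solve 3 (λ K c t → c :* ((con 1ℚ :+ K) :* t) :- (K :+ K :* c) :* t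
                                 := :- (t :* (K :- c))) refl

    S≡2Kw : S G ≡ K * w + K * w
    S≡2Kw = begin
      S G
        ≡⟨ S≡∑∣deviation∣ G ⟩
      ∣ deviation G fzero ∣ + sum (∣_∣ ∘ deviation G ∘ fsuc)
        ≡⟨ cong₂ _+_ (cong ∣_∣ deviation-hub) (∑ℚ.sum-cong-≗ (cong ∣_∣ ∘ deviation-rim)) ⟩
      ∣ K * w ∣ + sum {N} (λ _ → ∣ - w ∣)
        ≡⟨ cong₂ _+_ ∣Kw∣≡Kw (cong (λ u → sum {N} (λ _ → u)) ∣-w∣≡w) ⟩
      K * w + sum {N} (λ _ → w)
        ≡⟨ cong (K * w +_) (sum-const N w) ⟩
      K * w + K * w
        ∎
      where
      open ≡-Reasoning
      ∣Kw∣≡Kw : ∣ K * w ∣ ≡ K * w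
      ∣Kw∣≡Kw = 0≤p⇒∣p∣≡p (0≤p*q (0≤ℕtoℚ N) 0≤w)
      ∣-w∣≡w : ∣ - w ∣ ≡ w
      ∣-w∣≡w = trans (∣-p∣≡∣p∣ w) (0≤p⇒∣p∣≡p 0≤w)

    Var≡½wS : Var G ≡ ½ * w * S G
    Var≡½wS = begin
      Var G
        ≡⟨ Var≡inv*∑deviation² G ⟩
      t * (d fzero * d fzero + sum (λ i → d (fsuc i) * d (fsuc i)))
        ≡⟨ cong (t *_) (cong₂ _+_ (cong₂ _*_ deviation-hub deviation-hub)
                                  (∑ℚ.sum-cong-≗ (λ i → cong₂ _*_ (deviation-rim i) (deviation-rim i)))) ⟩
      t * (K * w * (K * w) + sum {N} (λ _ → - w * - w))
        ≡⟨ cong (λ u → t * (K * w * (K * w) + u)) (sum-const N (- w * - w)) ⟩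
      t * (K * w * (K * w) + K * (- w * - w))
        ≡⟨ factor t K w ⟩
      K * w * w * ((1ℚ + K) * t)
        ≡⟨ cong (K * w * w *_) [1+K]*t≡1 ⟩
      K * w * w * 1ℚ
        ≡⟨ regroup K w ⟩
      ½ * w * (K * w + K * w)
        ≡⟨ cong (½ * w *_) S≡2Kw ⟨
      ½ * w * S G
        ∎
      where
      open ≡-Reasoning
      d : Fin (suc N) → ℚ
      d = deviation G
      factor : ∀ t K w → t * (K * w * (K * w) + K * (- w * - w)) ≡ K * w * w * ((1ℚ + K) * t)
      factor = solve 3 (λ t K w → t :* (K :* w :* (K :* w) :+ K :* (:- w :* :- w))
                               := K :* w :* w :* ((con 1ℚ :+ K) :* t)) refl
      regroup : ∀ K w → K * w * w * 1ℚ ≡ ½ * w * (K * w + K * w)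
      regroup = solve 2 (λ K w → K :* w :* w :* con 1ℚ := con ½ :* w :* (K :* w :+ K :* w)) refl

    Ω≡½w : Ω G ≡ ½ * w
    Ω≡½w = trans (cong (λ v → divQ v (S G)) Var≡½wS) (divQ[r*q,q]≡r (½ * w) (S G) S≢0)
      where
      S≢0 : S G ≢ 0ℚ
      S≢0 S≡0 = <-irrefl (sym S≡0) (0<S G irregular)

    ∣Ω-½∣≡½t[1+c] : ∣ Ω G - ½ ∣ ≡ ½ * (t * (1ℚ + c))
    ∣Ω-½∣≡½t[1+c] = begin
      ∣ Ω G - ½ ∣                      ≡⟨ cong (λ u → ∣ u - ½ ∣) Ω≡½w ⟩
      ∣ ½ * w - ½ * 1ℚ ∣               ≡⟨ cong (λ u → ∣ ½ * w - ½ * u ∣) [1+K]*t≡1 ⟨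
      ∣ ½ * w - ½ * ((1ℚ + K) * t) ∣   ≡⟨ cong ∣_∣ (simplify t K c) ⟩
      ∣ - (½ * (t * (1ℚ + c))) ∣       ≡⟨ ∣-p∣≡∣p∣ _ ⟩
      ∣ ½ * (t * (1ℚ + c)) ∣           ≡⟨ 0≤p⇒∣p∣≡p 0≤½t[1+c] ⟩
      ½ * (t * (1ℚ + c))               ∎
      where
      open ≡-Reasoning
      0≤½t[1+c] : 0ℚ ≤ ½ * (t * (1ℚ + c))
      0≤½t[1+c] = 0≤p*q (nonNegative⁻¹ ½) (0≤p*q (0≤inv (suc N)) (subst (0ℚ ≤_) (ℕtoℚ-suc C) (0≤ℕtoℚ (suc C))))
      simplify : ∀ t K c → ½ * (t * (K - c)) - ½ * ((1ℚ + K) * t) ≡ - (½ * (t * (1ℚ + c)))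
      simplify = solve 3 (λ t K c → con ½ :* (t :* (K :- c)) :- con ½ :* ((con 1ℚ :+ K) :* t)
                                 := :- (con ½ :* (t :* (con 1ℚ :+ c)))) refl

  k*↧ε≤m⇒k≤ε*m : ∀ {ε} → 0ℚ < ε → ∀ {k m} → k ℕ.* ↧ₙ ε ℕ.≤ m → ℕtoℚ k ≤ ε * ℕtoℚ m
  k*↧ε≤m⇒k≤ε*m {mkℚ (ℤ.-[1+ _ ]) _ _} 0<ε = ⊥-elim (ℤ.Positive.pos (positive 0<ε))
  k*↧ε≤m⇒k≤ε*m {mkℚ (ℤ.+ zero)  _ _} 0<ε = ⊥-elim (ℤ.Positive.pos (positive 0<ε))
  k*↧ε≤m⇒k≤ε*m {ε@(mkℚ (ℤ.+ suc p) d _)} _ {k} {m} k*↧ε≤m =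
    toℚᵘ-cancel-≤ (ℚᵘₚ.≤-respʳ-≃ (ℚᵘₚ.≃-sym (toℚᵘ-homo-* ε (ℕtoℚ m))) k≤ε*m)
    where
    k*[1+d]≤[1+p]*m : k ℕ.* (suc d ℕ.* 1) ℕ.≤ suc p ℕ.* m
    k*[1+d]≤[1+p]*m = ℕₚ.≤-trans (ℕₚ.≤-reflexive (cong (k ℕ.*_) (ℕₚ.*-identityʳ (suc d))))
                        (ℕₚ.≤-trans k*↧ε≤m (ℕₚ.m≤n*m m (suc p)))
    k≤ε*m : toℚᵘ (ℕtoℚ k) ℚᵘ.≤ toℚᵘ ε ℚᵘ.* toℚᵘ (ℕtoℚ m)
    k≤ε*m rewrite ℕtoℚ≡mkℚ k | ℕtoℚ≡mkℚ m = ℚᵘ.*≤* (begin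
      ℤ.+ k ℤ.* ℤ.+ (suc d ℕ.* 1)        ≡⟨ ℤₚ.pos-* k (suc d ℕ.* 1) ⟨
      ℤ.+ (k ℕ.* (suc d ℕ.* 1))          ≤⟨ ℤ.+≤+ k*[1+d]≤[1+p]*m ⟩
      ℤ.+ (suc p ℕ.* m)                  ≡⟨ ℤₚ.pos-* (suc p) m ⟩
      ℤ.+ suc p ℤ.* ℤ.+ m                ≡⟨ ℤₚ.*-identityʳ _ ⟨
      ℤ.+ suc p ℤ.* ℤ.+ m ℤ.* ℤ.1ℤ       ∎)
      where open ℤₚ.≤-Reasoning

  ½*inv*[1+C]<ε : ∀ {ε} → 0ℚ < ε → ∀ C N → (2 ℕ.+ C) ℕ.* ↧ₙ ε ℕ.≤ suc N →
                  ½ * (inv (suc N) * (1ℚ + ℕtoℚ C)) < ε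
  ½*inv*[1+C]<ε {ε} 0<ε C N [2+C]*↧ε≤n = *-cancelʳ-<-nonNeg (n + n) {{nonNegative 0≤n+n}} (begin-strict
    ½ * (t * (1ℚ + c)) * (n + n)     ≡⟨ regroup t c n ⟩
    (1ℚ + c) * (n * t)               ≡⟨ cong ((1ℚ + c) *_) (ℕtoℚ*inv≡1 (suc N)) ⟩
    (1ℚ + c) * 1ℚ                    ≡⟨ *-identityʳ (1ℚ + c) ⟩
    1ℚ + c                           <⟨ p<p+q (1ℚ + c) (positive⁻¹ 1ℚ) ⟩
    1ℚ + c + 1ℚ                      ≡⟨ +-comm (1ℚ + c) 1ℚ ⟩
    1ℚ + (1ℚ + c)                    ≡⟨ cong (1ℚ +_) (ℕtoℚ-suc C) ⟨
    1ℚ + ℕtoℚ (suc C)                ≡⟨ ℕtoℚ-suc (suc C) ⟨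
    ℕtoℚ (2 ℕ.+ C)                   ≤⟨ k*↧ε≤m⇒k≤ε*m 0<ε {2 ℕ.+ C} [2+C]*↧ε≤n+n ⟩
    ε * ℕtoℚ (suc N ℕ.+ suc N)       ≡⟨ cong (ε *_) (ℕtoℚ-homo-+ (suc N) (suc N)) ⟩
    ε * (n + n)                      ∎)
    where
    open ≤-Reasoning
    n t c : ℚ
    n = ℕtoℚ (suc N)
    t = inv (suc N)
    c = ℕtoℚ C
    0≤n+n : 0ℚ ≤ n + n
    0≤n+n = +-mono-≤ (0≤ℕtoℚ (suc N)) (0≤ℕtoℚ (suc N))
    [2+C]*↧ε≤n+n : (2 ℕ.+ C) ℕ.* ↧ₙ ε ℕ.≤ suc N ℕ.+ suc N
    [2+C]*↧ε≤n+n = ℕₚ.≤-trans [2+C]*↧ε≤n (ℕₚ.m≤m+n (suc N) (suc N))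
    regroup : ∀ t c n → ½ * (t * (1ℚ + c)) * (n + n) ≡ (1ℚ + c) * (n * t)
    regroup = solve 3 (λ t c n → con ½ :* (t :* (con 1ℚ :+ c)) :* (n :+ n) := (con 1ℚ :+ c) :* (n :* t)) refl

  n₀ : ℚ → ℕ
  n₀ ε = 5 ℕ.+ 5 ℕ.* ↧ₙ ε

  5≤n : ∀ {ε n} → n₀ ε ℕ.≤ n → 5 ℕ.≤ n
  5≤n {ε} = ℕₚ.≤-trans (ℕₚ.m≤m+n 5 (5 ℕ.* ↧ₙ ε))

  [2+C]*↧ε≤n : ∀ {ε C n} → C ℕ.≤ 3 → n₀ ε ℕ.≤ n → (2 ℕ.+ C) ℕ.* ↧ₙ ε ℕ.≤ n
  [2+C]*↧ε≤n {ε} C≤3 n₀≤n =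
    ℕₚ.≤-trans (ℕₚ.*-monoˡ-≤ (↧ₙ ε) (s≤s (s≤s C≤3))) (ℕₚ.≤-trans (ℕₚ.m≤n+m (5 ℕ.* ↧ₙ ε) 5) n₀≤n)

  two-degrees-near-½ : ∀ {ε} → 0ℚ < ε → ∀ {N C} (G : Graph (suc N)) →
    degree G fzero ≡ N → (∀ i → degree G (fsuc i) ≡ C) → C ℕ.< N → C ℕ.≤ 3 → n₀ ε ℕ.≤ suc N →
    Irregular G × (∣ Ω G - ½ ∣ < ε)
  two-degrees-near-½ {ε} 0<ε {N} {C} G hub rim C<N C≤3 n₀≤n =
    irregular , subst (_< _) (sym ∣Ω-½∣≡½t[1+c]) (½*inv*[1+C]<ε 0<ε C N ([2+C]*↧ε≤n {ε} C≤3 n₀≤n))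
    where open TwoDegrees G hub rim C<N

  -- The star and the wheel

  hub⇒connected : ∀ {n} (G : Graph (suc n)) → (∀ j → adj G fzero (fsuc j) ≡ true) → Connected G
  hub⇒connected G hub fzero    fzero    = here
  hub⇒connected G hub fzero    (fsuc j) = step (hub j) here
  hub⇒connected G hub (fsuc i) fzero    = step (trans (adj-sym G (fsuc i) fzero) (hub i)) here
  hub⇒connected G hub (fsuc i) (fsuc j) = step (trans (adj-sym G (fsuc i) fzero) (hub i)) (step (hub j) here)

  star-connected : ∀ n → Connected (star (suc n))
  star-connected n = hub⇒connected (star (suc n)) (λ _ → refl)

  wheel-connected : ∀ n → Connected (wheel (suc n))
  wheel-connected n = hub⇒connected (wheel (suc n)) (λ _ → refl)

  star-hub : ∀ n → degree (star (suc n)) fzero ≡ n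
  star-hub n = trans (degree≡∑ (star (suc n)) fzero) (trans (∑ℕ-const n 1) (ℕₚ.*-identityʳ n))

  star-leaf : ∀ n i → degree (star (suc n)) (fsuc i) ≡ 1
  star-leaf n i = trans (degree≡∑ (star (suc n)) (fsuc i)) (cong suc no-other-leaf)
    where
    no-other-leaf : ∑ℕ.sum {n} (λ j → b2n (not (toℕ i ≡ᵇ toℕ j) ∧ false)) ≡ 0
    no-other-leaf = trans (∑ℕ.sum-cong-≗ {n} (λ j → cong b2n (∧-zeroʳ (not (toℕ i ≡ᵇ toℕ j)))))
                          (∑ℕ.sum-replicate-zero n)

  wheel-hub : ∀ n → degree (wheel (suc n)) fzero ≡ n
  wheel-hub n = trans (degree≡∑ (wheel (suc n)) fzero) (trans (∑ℕ-const n 1) (ℕₚ.*-identityʳ n))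

  -- In wheel (N + 2) the rim vertex fsuc k is joined to fsuc l iff rim-arc N k l or rim-arc N l k.
  rim-arc : ℕ → ℕ → ℕ → Bool
  rim-arc N k l = (suc k ≡ᵇ l) ∨ ((k ≡ᵇ 0) ∧ (l ≡ᵇ N))

  next : ℕ → ℕ → ℕ
  next N k = if k ≡ᵇ N then 0 else suc k

  prev : ℕ → ℕ → ℕ
  prev N zero    = N
  prev N (suc k) = k

  next-last : ∀ N → next N N ≡ 0
  next-last N rewrite ≡ᵇ-refl N = refl

  next-suc : ∀ {N k} → k ≢ N → next N k ≡ suc k
  next-suc {N} {k} k≢N rewrite dec-false (k ℕₚ.≟ N) k≢N = refl

  next<1+N : ∀ {N k} → k ℕ.≤ N → next N k ℕ.< suc N
  next<1+N {N} {k} k≤N with k ℕₚ.≟ N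
  ... | yes refl rewrite next-last N = s≤s z≤n
  ... | no k≢N   rewrite next-suc k≢N = s≤s (ℕₚ.≤∧≢⇒< k≤N k≢N)

  prev<1+N : ∀ {N k} → k ℕ.≤ N → prev N k ℕ.< suc N
  prev<1+N {N} {zero}  _     = ℕₚ.n<1+n N
  prev<1+N {N} {suc k} 1+k≤N = ℕₚ.m≤n⇒m≤1+n 1+k≤N

  next≢self : ∀ {N k} → 1 ℕ.≤ N → next N k ≢ k
  next≢self {N} {k} 1≤N with k ℕₚ.≟ N
  ... | yes refl rewrite next-last N = λ 0≡N → ℕₚ.<⇒≢ 1≤N 0≡N
  ... | no k≢N   rewrite next-suc k≢N = ℕₚ.1+n≢n

  prev≢self : ∀ {N k} → 1 ℕ.≤ N → prev N k ≢ k
  prev≢self {N} {zero}  1≤N N≡0 = ℕₚ.<⇒≢ 1≤N (sym N≡0)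
  prev≢self {N} {suc k} _       = ℕₚ.1+n≢n ∘ sym

  next≢prev : ∀ {N k} → 2 ℕ.≤ N → next N k ≢ prev N k
  next≢prev {suc N} {k} (s≤s 1≤N) with k ℕₚ.≟ suc N
  ... | yes refl rewrite next-last (suc N) = ℕₚ.<⇒≢ 1≤N
  ... | no k≢N rewrite next-suc k≢N with k
  ...   | zero  = ℕₚ.<⇒≢ 1≤N ∘ ℕₚ.suc-injective
  ...   | suc k = ℕₚ.<⇒≢ (ℕₚ.<-trans (ℕₚ.n<1+n k) (ℕₚ.n<1+n (suc k))) ∘ sym

  ∨-regroup : ∀ x y z w → (x ∨ y) ∨ (z ∨ w) ≡ (x ∨ w) ∨ (z ∨ y)
  ∨-regroup = ∨-solve 4 (λ x y z w → (x ⊕ y) ⊕ (z ⊕ w) ⊜ (x ⊕ w) ⊕ (z ⊕ y)) refl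

  arc-or-reverse≡next : ∀ {N k l} → l ℕ.≤ N →
                        ((suc k ≡ᵇ l) ∨ ((l ≡ᵇ 0) ∧ (k ≡ᵇ N))) ≡ (l ≡ᵇ next N k)
  arc-or-reverse≡next {N} {k} {l} l≤N with k ℕₚ.≟ N
  ... | yes refl rewrite next-last N | ≡ᵇ-refl N | ∧-identityʳ (l ≡ᵇ 0)
                       | dec-false (suc N ℕₚ.≟ l) (λ 1+N≡l → ℕₚ.<-irrefl (sym 1+N≡l) (s≤s l≤N)) = refl
  ... | no k≢N   rewrite next-suc k≢N | dec-false (k ℕₚ.≟ N) k≢N | ∧-zeroʳ (l ≡ᵇ 0)
                       | ∨-identityʳ (suc k ≡ᵇ l) = ≡ᵇ-sym (suc k) l

  arc-or-reverse≡prev : ∀ {N k l} → ((suc l ≡ᵇ k) ∨ ((k ≡ᵇ 0) ∧ (l ≡ᵇ N))) ≡ (l ≡ᵇ prev N k)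
  arc-or-reverse≡prev {N} {zero}  {l} = refl
  arc-or-reverse≡prev {N} {suc k} {l} = ∨-identityʳ (l ≡ᵇ k)

  rim-adjacent : ∀ {N k l} → l ℕ.≤ N →
                 (rim-arc N k l ∨ rim-arc N l k) ≡ ((l ≡ᵇ next N k) ∨ (l ≡ᵇ prev N k))
  rim-adjacent {N} {k} {l} l≤N = begin
    rim-arc N k l ∨ rim-arc N l k
      ≡⟨ ∨-regroup (suc k ≡ᵇ l) ((k ≡ᵇ 0) ∧ (l ≡ᵇ N)) (suc l ≡ᵇ k) ((l ≡ᵇ 0) ∧ (k ≡ᵇ N)) ⟩
    ((suc k ≡ᵇ l) ∨ ((l ≡ᵇ 0) ∧ (k ≡ᵇ N))) ∨ ((suc l ≡ᵇ k) ∨ ((k ≡ᵇ 0) ∧ (l ≡ᵇ N)))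
      ≡⟨ cong₂ _∨_ (arc-or-reverse≡next l≤N) (arc-or-reverse≡prev {N} {k} {l}) ⟩
    (l ≡ᵇ next N k) ∨ (l ≡ᵇ prev N k)
      ∎
    where open ≡-Reasoning

  b2n-rim-adjacent : ∀ {N k l} → 2 ℕ.≤ N → l ℕ.≤ N →
    b2n (not (k ≡ᵇ l) ∧ (rim-arc N k l ∨ rim-arc N l k)) ≡ b2n (l ≡ᵇ next N k) ℕ.+ b2n (l ≡ᵇ prev N k)
  b2n-rim-adjacent {N} {k} {l} 2≤N@(s≤s 1≤N) l≤N rewrite rim-adjacent {N} {k} {l} l≤N
    with l ℕₚ.≟ next N k | l ℕₚ.≟ prev N k
  ... | yes refl | _
    rewrite ≡ᵇ-refl (next N k) | dec-false (next N k ℕₚ.≟ prev N k) (next≢prev 2≤N)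
          | dec-false (k ℕₚ.≟ next N k) (next≢self (s≤s z≤n) ∘ sym) = refl
  ... | no l≢next | yes refl
    rewrite dec-false (prev N k ℕₚ.≟ next N k) l≢next | ≡ᵇ-refl (prev N k)
          | dec-false (k ℕₚ.≟ prev N k) (prev≢self (s≤s z≤n) ∘ sym) = refl
  ... | no l≢next | no l≢prev
    rewrite dec-false (l ℕₚ.≟ next N k) l≢next | dec-false (l ℕₚ.≟ prev N k) l≢prev
    = cong b2n (∧-zeroʳ (not (k ≡ᵇ l)))

  wheel-rim : ∀ N i → 2 ℕ.≤ N → degree (wheel (suc (suc N))) (fsuc i) ≡ 3
  wheel-rim N i 2≤N = begin
    degree (wheel (suc (suc N))) (fsuc i)
      ≡⟨ degree≡∑ (wheel (suc (suc N))) (fsuc i) ⟩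
    b2n (((k ≡ᵇ 0) ∧ false) ∨ true) ℕ.+ ∑ℕ.sum rim-neighbour
      ≡⟨ cong₂ ℕ._+_ (cong b2n (∨-zeroʳ ((k ≡ᵇ 0) ∧ false)))
                     (∑ℕ.sum-cong-≗ (λ j → b2n-rim-adjacent {N} {k} 2≤N (Finₚ.toℕ≤pred[n] j))) ⟩
    1 ℕ.+ ∑ℕ.sum (λ j → hits (next N k) j ℕ.+ hits (prev N k) j)
      ≡⟨ cong suc (∑ℕ.∑-distrib-+ (hits (next N k)) (hits (prev N k))) ⟩
    1 ℕ.+ (∑ℕ.sum (hits (next N k)) ℕ.+ ∑ℕ.sum (hits (prev N k)))
      ≡⟨ cong suc (cong₂ ℕ._+_ (∑ℕ[j≡v]≡1 (next<1+N k≤N)) (∑ℕ[j≡v]≡1 (prev<1+N k≤N))) ⟩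
    3 ∎
    where
    open ≡-Reasoning
    k : ℕ
    k = toℕ i
    k≤N : k ℕ.≤ N
    k≤N = Finₚ.toℕ≤pred[n] i
    rim-neighbour : Vector ℕ (suc N)
    rim-neighbour j = b2n (not (k ≡ᵇ toℕ j) ∧ (rim-arc N k (toℕ j) ∨ rim-arc N (toℕ j) k))
    hits : ℕ → Vector ℕ (suc N)
    hits v j = b2n (toℕ j ≡ᵇ v)

  star-near-½ : ∀ {ε} → 0ℚ < ε → ∀ n → n₀ ε ℕ.≤ n →
    Connected (star n) × Irregular (star n) × (∣ Ω (star n) - ½ ∣ < ε)
  star-near-½ {ε} 0<ε (suc N) n₀≤n =
    star-connected N , two-degrees-near-½ 0<ε (star (suc N)) (star-hub N) (star-leaf N) 1<N (s≤s z≤n) n₀≤n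
    where
    1<N : 1 ℕ.< N
    1<N = ℕₚ.≤-trans (s≤s (s≤s z≤n)) (ℕₚ.≤-pred (5≤n {ε} n₀≤n))

  wheel-near-½ : ∀ {ε} → 0ℚ < ε → ∀ n → n₀ ε ℕ.≤ n →
    Connected (wheel n) × Irregular (wheel n) × (∣ Ω (wheel n) - ½ ∣ < ε)
  wheel-near-½ 0<ε (suc zero) (s≤s ())
  wheel-near-½ {ε} 0<ε (suc (suc N)) n₀≤n =
    wheel-connected (suc N) ,
    two-degrees-near-½ 0<ε (wheel (suc (suc N))) (wheel-hub (suc N)) (λ i → wheel-rim N i 2≤N)
                       (s≤s 3≤N) ℕₚ.≤-refl n₀≤n
    where
    3≤N : 3 ℕ.≤ N
    3≤N = ℕₚ.≤-pred (ℕₚ.≤-pred (5≤n {ε} n₀≤n))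
    2≤N : 2 ℕ.≤ N
    2≤N = ℕₚ.≤-trans (ℕₚ.n≤1+n 2) 3≤N

open import Defs
open import Data.Nat using (ℕ; _≤_)
open import Data.Rational using (ℚ; 0ℚ; ½; _*_; _-_; ∣_∣; _<_)
open import Data.Product using (Σ; ∃-syntax; _×_; _,_)
open Irregularity using (Ω<½∧Var<½S; star-near-½; wheel-near-½)

proposition16 :
    (∀ {n} (G : Graph n) → Connected G → Irregular G → (Ω G < ½) × (Var G < ½ * S G))
    × (∀ (ε : ℚ) → 0ℚ < ε → ∃[ n₀ ] ∀ n → n₀ ≤ n →
        Σ (Graph n) (λ G → Connected G × Irregular G × (∣ Ω G - ½ ∣ < ε)))
    × (∀ (ε : ℚ) → 0ℚ < ε → ∃[ n₀ ] ∀ n → n₀ ≤ n →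
        Connected (star n) × Irregular (star n) × (∣ Ω (star n) - ½ ∣ < ε))
    × (∀ (ε : ℚ) → 0ℚ < ε → ∃[ n₀ ] ∀ n → n₀ ≤ n →
        Connected (wheel n) × Irregular (wheel n) × (∣ Ω (wheel n) - ½ ∣ < ε))
proposition16 =
  (λ G _ → Ω<½∧Var<½S G) ,
  (λ ε 0<ε → Irregularity.n₀ ε , λ n n₀≤n → star n , star-near-½ 0<ε n n₀≤n) ,
  (λ ε 0<ε → Irregularity.n₀ ε , star-near-½ 0<ε) ,
  (λ ε 0<ε → Irregularity.n₀ ε , wheel-near-½ 0<ε)
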